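{- Let $m\ge1$, $a_1,\ldots,a_m\in\mathbb Z$, and let $f:\mathbb N\to\mathbb Z$ satisfy $k^3\mid f(k)$ for all $k\in\mathbb N$. Then for any positive integer $n$, $$\sum_{k=0}^{n-1}\big(f(k+1)-f(k)\big)\prod_{i=1}^m\binom{a_in-1}{k}\binom{ -a_in-1}k\equiv n^2(a_1^2+\cdots+a_m^2)\sum_{0<k<n}\frac{f(k)}{k^2}\prod_{i=1}^m\binom{a_in-1}k\binom{ -a_in-1}k\pmod {n^3}.$$
   Context: For an integer $x$ and $k\in\mathbb N$, $\binom xk=x(x-1)\cdots(x-k+1)/k!$. -}

module Defs where

open import Data.Nat as ℕ using (ℕ; zero; suc; _!)
open import Data.Nat.Properties using (_!≢0)
open import Data.Integer using (ℤ; +_; _+_; _-_; _*_; _/ℕ_; 1ℤ; 0ℤ)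
open import Data.Fin using (Fin)
import Data.Fin as Fin

falling : ℤ → ℕ → ℤ
falling x zero    = 1ℤ
falling x (suc k) = falling x k * (x - + k)

-- generalized binomial coefficient  binom x k = x(x-1)...(x-k+1)/k!
-- (the division is exact; _/ℕ_ is integer division)
binom : ℤ → ℕ → ℤ
binom x k = (falling x k /ℕ (k !)) {{k !≢0}}

sumTo : ℕ → (ℕ → ℤ) → ℤ
sumTo zero    g = 0ℤ
sumTo (suc n) g = sumTo n g + g n

prodFin : (m : ℕ) → (Fin m → ℤ) → ℤ
prodFin zero    g = 1ℤ
prodFin (suc m) g = g Fin.zero * prodFin m (λ i → g (Fin.suc i))

sumFin : (m : ℕ) → (Fin m → ℤ) → ℤ
sumFin zero    g = 0ℤ
sumFin (suc m) g = g Fin.zero + sumFin m (λ i → g (Fin.suc i))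

module Submission where

-- Put c = a n and Q_c(k) = binom (c-1) k · binom (-c-1) k.  The ratio recurrence
-- for binomial coefficients gives  K²(Q_c(K) - Q_c(k)) = -c² Q_c(k)  with K = k+1, and the
-- absorption identity shows that c divides K(Q_c(K) - Q_c(k)).  Multiplying such factors over
-- i = 1..m, the products P(k) = ∏ᵢ Q_{aᵢn}(k) satisfy, with S = Σ aᵢ²,
--     n ∣ K(P(K) - P(k))   and   n³ ∣ K³(P(K) - P(k)) + n² S K P(K)            (*)
-- (the pair (P k, P K) is "adapted", proved by induction on m).  Summation by parts turns the
-- left-hand sum into  f(n)P(n-1) - f(0)P(0) - Σ_{k<n-1} f(K)(P(K) - P(k)),  and writing
-- f(K) = g K³, (*) makes each f(K)(P(K) - P(k)) congruent to -n² S (f(K)/K²) P(K) mod n³,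
-- while n³ ∣ f(n) and f(0) = 0.

open import Defs
open import Data.Nat as ℕ using (ℕ; suc; _≤_; _∸_)
open import Data.Integer using (ℤ; +_; _+_; _-_; _*_; -_; _^_; _/ℕ_)
open import Data.Integer.Divisibility using (_∣_)
open import Data.Fin using (Fin)
import Data.Fin as Fin

open import Data.Nat using (zero; _!)
open import Data.Nat.Properties using (_!≢0; 1+n≢0)
import Data.Nat.DivMod as ℕD
open import Data.Integer using (-[1+_]; 0ℤ; 1ℤ)
open import Data.Integer.Properties using (pos-*; *-cancelʳ-≡; *-cancelˡ-≡)
open import Data.Integer.Divisibility.Signed
  using (divides; ∣ᵤ⇒∣; ∣⇒∣ᵤ; ∣-trans; ∣m∣n⇒∣m+n; ∣m∣n⇒∣m-n; ∣m+n∣n⇒∣m; ∣n⇒∣m*n; ∣m⇒∣m*n;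
         *-monoʳ-∣)
  renaming (_∣_ to _∣ˢ_)
open import Data.Integer.Tactic.RingSolver using (solve-∀)
open import Relation.Binary.PropositionalEquality
open import Relation.Nullary using (contradiction)
open ≡-Reasoning

∣-zero : ∀ {d} → d ∣ˢ 0ℤ
∣-zero = divides 0ℤ refl

/ℕ-exact : ∀ (q : ℤ) (d : ℕ) .{{_ : ℕ.NonZero d}} → (q * + d) /ℕ d ≡ q
/ℕ-exact (+ a) d = begin
  (+ a * + d) /ℕ d  ≡⟨ cong (_/ℕ d) (sym (pos-* a d)) ⟩
  + (a ℕ.* d ℕ./ d) ≡⟨ cong +_ (ℕD.m*n/n≡m a d) ⟩
  + a               ∎
/ℕ-exact -[1+ a ] d@(suc d-1) = negative (d-1 ℕ.+ a ℕ.* d) refl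
  where
  -- -[1+ a ] * + d  computes to  -[1+ n ]  with  suc n = suc a * d.
  negative : ∀ n → suc n ≡ suc a ℕ.* d → -[1+ n ] /ℕ d ≡ -[1+ a ]
  negative n eq with suc n ℕ.% d in remainder
  ... | zero  = cong (λ z → - (+ z)) (trans (cong (ℕ._/ d) eq) (ℕD.m*n/n≡m (suc a) d))
  ... | suc r = contradiction
    (trans (sym remainder) (trans (cong (ℕ._% d) eq) (ℕD.m*n%n≡0 (suc a) d))) 1+n≢0

falling-suc : ∀ x k → falling x (suc k) ≡ x * falling (x - + 1) k
falling-suc x zero    = unit x
  where
  unit : ∀ x → 1ℤ * (x - + 0) ≡ x * 1ℤ
  unit = solve-∀
falling-suc x (suc k) = begin
  falling x (suc k) * (x - + suc k)              ≡⟨ cong (_* (x - + suc k)) (falling-suc x k) ⟩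
  x * falling (x - + 1) k * (x - (+ 1 + + k))    ≡⟨ regroup x (falling (x - + 1) k) (+ k) ⟩
  x * (falling (x - + 1) k * (x - + 1 - + k))    ∎
  where
  regroup : ∀ x F k → x * F * (x - (+ 1 + k)) ≡ x * (F * (x - + 1 - k))
  regroup = solve-∀

falling-pascal : ∀ x j → falling (+ 1 + x) (suc j) ≡ falling x (suc j) + + suc j * falling x j
falling-pascal x j = begin
  falling (+ 1 + x) (suc j)              ≡⟨ falling-suc (+ 1 + x) j ⟩
  (+ 1 + x) * falling (+ 1 + x - + 1) j  ≡⟨ cong (λ y → (+ 1 + x) * falling y j) (cancel x) ⟩
  (+ 1 + x) * falling x j                ≡⟨ split x (falling x j) (+ j) ⟩
  falling x j * (x - + j) + + suc j * falling x j ∎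
  where
  cancel : ∀ x → + 1 + x - + 1 ≡ x
  cancel = solve-∀
  split : ∀ x F j → (+ 1 + x) * F ≡ F * (x - j) + (+ 1 + j) * F
  split = solve-∀

-- k! divides x(x-1)⋯(x-k+1) for every integer x.  By induction on k; for the step, Pascal's
-- rule shows that divisibility at x and at x+1 are equivalent, and it holds at x = 0.
factorial-∣-falling : ∀ k x → + (k !) ∣ˢ falling x k
factorial-∣-falling zero    x = divides 1ℤ refl
factorial-∣-falling (suc j) = everywhere
  where
  D : ℤ
  D = + (suc j !)

  pascal-term : ∀ x → D ∣ˢ + suc j * falling x j
  pascal-term x = subst (_∣ˢ + suc j * falling x j) (sym (pos-* (suc j) (j !)))
    (*-monoʳ-∣ (+ suc j) (factorial-∣-falling j x))

  up : ∀ x → D ∣ˢ falling x (suc j) → D ∣ˢ falling (+ 1 + x) (suc j)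
  up x h = subst (D ∣ˢ_) (sym (falling-pascal x j)) (∣m∣n⇒∣m+n h (pascal-term x))

  down : ∀ x → D ∣ˢ falling (+ 1 + x) (suc j) → D ∣ˢ falling x (suc j)
  down x h = ∣m+n∣n⇒∣m (subst (D ∣ˢ_) (falling-pascal x j) h) (pascal-term x)

  at-zero : D ∣ˢ falling 0ℤ (suc j)
  at-zero = subst (D ∣ˢ_) (sym (falling-suc 0ℤ j)) (∣m⇒∣m*n (falling (0ℤ - + 1) j) ∣-zero)

  everywhere : ∀ x → D ∣ˢ falling x (suc j)
  everywhere (+ zero)        = at-zero
  everywhere (+ suc n)       = up (+ n) (everywhere (+ n))
  everywhere -[1+ zero ]     = down -[1+ zero ] at-zero
  everywhere -[1+ suc n ]    = down -[1+ suc n ] (everywhere -[1+ n ])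

binom-spec : ∀ x k → binom x k * + (k !) ≡ falling x k
binom-spec x k with factorial-∣-falling k x
... | divides q eq = begin
  binom x k * + (k !)
    ≡⟨ cong (λ y → (y /ℕ (k !)) {{k !≢0}} * + (k !)) eq ⟩
  ((q * + (k !)) /ℕ (k !)) {{k !≢0}} * + (k !)
    ≡⟨ cong (_* + (k !)) (/ℕ-exact q (k !) {{k !≢0}}) ⟩
  q * + (k !)
    ≡⟨ sym eq ⟩
  falling x k
    ∎

binom-suc-spec : ∀ x j → binom x (suc j) * + suc j * + (j !) ≡ falling x (suc j)
binom-suc-spec x j = begin
  binom x (suc j) * + suc j * + (j !)    ≡⟨ assoc (binom x (suc j)) (+ suc j) (+ (j !)) ⟩
  binom x (suc j) * (+ suc j * + (j !))  ≡⟨ cong (binom x (suc j) *_) (sym (pos-* (suc j) (j !))) ⟩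
  binom x (suc j) * + (suc j !)          ≡⟨ binom-spec x (suc j) ⟩
  falling x (suc j)                      ∎
  where
  assoc : ∀ b s f → b * s * f ≡ b * (s * f)
  assoc = solve-∀

binom-ratio : ∀ x j → binom x (suc j) * + suc j ≡ binom x j * (x - + j)
binom-ratio x j = *-cancelʳ-≡ _ _ (+ (j !)) {{j !≢0}} (begin
  binom x (suc j) * + suc j * + (j !)  ≡⟨ binom-suc-spec x j ⟩
  falling x j * (x - + j)              ≡⟨ cong (_* (x - + j)) (sym (binom-spec x j)) ⟩
  binom x j * + (j !) * (x - + j)      ≡⟨ swap (binom x j) (+ (j !)) (x - + j) ⟩
  binom x j * (x - + j) * + (j !)      ∎)
  where
  swap : ∀ b f y → b * f * y ≡ b * y * f
  swap = solve-∀

binom-absorption : ∀ x j → binom x (suc j) * + suc j ≡ x * binom (x - + 1) j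
binom-absorption x j = *-cancelʳ-≡ _ _ (+ (j !)) {{j !≢0}} (begin
  binom x (suc j) * + suc j * + (j !)      ≡⟨ binom-suc-spec x j ⟩
  falling x (suc j)                        ≡⟨ falling-suc x j ⟩
  x * falling (x - + 1) j                  ≡⟨ cong (x *_) (sym (binom-spec (x - + 1) j)) ⟩
  x * (binom (x - + 1) j * + (j !))        ≡⟨ assoc x (binom (x - + 1) j) (+ (j !)) ⟩
  x * binom (x - + 1) j * + (j !)          ∎)
  where
  assoc : ∀ x b f → x * (b * f) ≡ x * b * f
  assoc = solve-∀

-- The factor contributed by one aᵢ, with c = aᵢ n:  Q c k = binom (c-1) k · binom (-c-1) k.
Q : ℤ → ℕ → ℤ
Q c k = binom (c - + 1) k * binom (- c - + 1) k

-- Since (c-1-j)(-c-1-j) = (j+1)² - c², the ratio recurrence gives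
--   (j+1)² (Q c (j+1) - Q c j) = -c² Q c j.
Q-step-square : ∀ c j → + suc j * + suc j * (Q c (suc j) - Q c j) ≡ - (c * c) * Q c j
Q-step-square c j = begin
  K * K * (B₁ * C₁ - B₀ * C₀)                      ≡⟨ expand K B₁ C₁ (B₀ * C₀) ⟩
  B₁ * K * (C₁ * K) - K * K * (B₀ * C₀)            ≡⟨ cong₂ (λ u v → u * v - K * K * (B₀ * C₀))
                                                         (binom-ratio (c - + 1) j)
                                                         (binom-ratio (- c - + 1) j) ⟩
  B₀ * (c - + 1 - + j) * (C₀ * (- c - + 1 - + j))
    - K * K * (B₀ * C₀)                            ≡⟨ difference-of-squares c B₀ C₀ (+ j) ⟩
  - (c * c) * (B₀ * C₀)                            ∎
  where
  K = + suc j
  B₀ = binom (c - + 1) j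
  B₁ = binom (c - + 1) (suc j)
  C₀ = binom (- c - + 1) j
  C₁ = binom (- c - + 1) (suc j)
  expand : ∀ K b c q → K * K * (b * c - q) ≡ b * K * (c * K) - K * K * q
  expand = solve-∀
  difference-of-squares : ∀ c b₀ c₀ j →
    b₀ * (c - + 1 - j) * (c₀ * (- c - + 1 - j)) - (+ 1 + j) * (+ 1 + j) * (b₀ * c₀)
      ≡ - (c * c) * (b₀ * c₀)
  difference-of-squares = solve-∀

-- c divides (j+1)(Q c (j+1) - Q c j): by absorption (j+1)·W = c·Q c j for the integer
-- W = binom c (j+1)·binom (-c-1) j, so cancelling j+1 in Q-step-square leaves -c·W.
Q-step-divisible : ∀ c j → c ∣ˢ + suc j * (Q c (suc j) - Q c j)
Q-step-divisible c j = divides (- W) (*-cancelˡ-≡ K _ _ (begin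
  K * (K * (Q c (suc j) - Q c j))  ≡⟨ reassoc K (Q c (suc j) - Q c j) ⟩
  K * K * (Q c (suc j) - Q c j)    ≡⟨ Q-step-square c j ⟩
  - (c * c) * Q c j                ≡⟨ factor-c c (Q c j) ⟩
  - c * (c * Q c j)                ≡⟨ cong (- c *_) (sym absorbed) ⟩
  - c * (K * W)                    ≡⟨ rearrange K c W ⟩
  K * (- W * c)                    ∎))
  where
  K = + suc j
  W = binom c (suc j) * binom (- c - + 1) j
  absorbed : K * W ≡ c * Q c j
  absorbed = begin
    K * W                                               ≡⟨ swap K (binom c (suc j)) (binom (- c - + 1) j) ⟩
    binom c (suc j) * K * binom (- c - + 1) j           ≡⟨ cong (_* binom (- c - + 1) j) (binom-absorption c j) ⟩
    c * binom (c - + 1) j * binom (- c - + 1) j         ≡⟨ assoc c (binom (c - + 1) j) (binom (- c - + 1) j) ⟩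
    c * Q c j                                           ∎
    where
    swap : ∀ K b c → K * (b * c) ≡ b * K * c
    swap = solve-∀
    assoc : ∀ c b d → c * b * d ≡ c * (b * d)
    assoc = solve-∀
  reassoc : ∀ K x → K * (K * x) ≡ K * K * x
  reassoc = solve-∀
  factor-c : ∀ c q → - (c * c) * q ≡ - c * (c * q)
  factor-c = solve-∀
  rearrange : ∀ K c W → - c * (K * W) ≡ K * (- W * c)
  rearrange = solve-∀

-- Consecutive values p₀ = P(k), p₁ = P(k+1) of a sequence, with K = k+1, are adapted to N
-- with weight s when both congruences hold; the third-order one is exactly what turns
-- f(K)(p₁ - p₀) into -N² s (f(K)/K²) p₁ modulo N³ once K³ ∣ f(K).
record Adapted (N K s p₀ p₁ : ℤ) : Set where
  field
    first-order : N ∣ˢ K * (p₁ - p₀)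
    third-order : N ^ 3 ∣ˢ K ^ 3 * (p₁ - p₀) + N ^ 2 * s * (K * p₁)
open Adapted

adapted-one : ∀ N K → Adapted N K 0ℤ 1ℤ 1ℤ
adapted-one N K = record
  { first-order = subst (N ∣ˢ_) (sym (vanish₁ K)) ∣-zero
  ; third-order = subst (N ^ 3 ∣ˢ_) (sym (vanish₃ N K)) ∣-zero
  }
  where
  vanish₁ : ∀ K → K * (1ℤ - 1ℤ) ≡ 0ℤ
  vanish₁ = solve-∀
  vanish₃ : ∀ N K → K * (K * (K * 1ℤ)) * (1ℤ - 1ℤ) + N * (N * 1ℤ) * 0ℤ * (K * 1ℤ) ≡ 0ℤ
  vanish₃ = solve-∀

-- The third-order sum splits as
--   q₁·(old sum) + N² a²·K(q₁p₁ - q₀p₀) + K p₀·(K²(q₁ - q₀) + (aN)² q₀),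
-- whose last bracket vanishes.
adapted-* : ∀ {N K s p₀ p₁} (a q₀ q₁ : ℤ) →
  K * K * (q₁ - q₀) ≡ - ((a * N) * (a * N)) * q₀ →
  a * N ∣ˢ K * (q₁ - q₀) →
  Adapted N K s p₀ p₁ → Adapted N K (a ^ 2 + s) (q₀ * p₀) (q₁ * p₁)
adapted-* {N} {K} {s} {p₀} {p₁} a q₀ q₁ square-step divisible-step adapted = record
  { first-order = first
  ; third-order = subst (N ^ 3 ∣ˢ_) (sym third-split)
      (∣m∣n⇒∣m+n (∣n⇒∣m*n q₁ (third-order adapted)) (scaled first))
  }
  where
  c = a * N
  first : N ∣ˢ K * (q₁ * p₁ - q₀ * p₀)
  first = subst (N ∣ˢ_) (sym (first-split K q₀ q₁ p₀ p₁))
    (∣m∣n⇒∣m+n (∣m⇒∣m*n p₁ (∣-trans (divides a refl) divisible-step))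
               (∣n⇒∣m*n q₀ (first-order adapted)))
    where
    first-split : ∀ K q₀ q₁ p₀ p₁ →
      K * (q₁ * p₁ - q₀ * p₀) ≡ K * (q₁ - q₀) * p₁ + q₀ * (K * (p₁ - p₀))
    first-split = solve-∀

  scaled : ∀ {x} → N ∣ˢ x → N ^ 3 ∣ˢ N ^ 2 * a ^ 2 * x
  scaled (divides d refl) = divides (a ^ 2 * d) (regroup N a d)
    where
    regroup : ∀ N a d → N * (N * 1ℤ) * (a * (a * 1ℤ)) * (d * N)
                        ≡ a * (a * 1ℤ) * d * (N * (N * (N * 1ℤ)))
    regroup = solve-∀

  third-split : K ^ 3 * (q₁ * p₁ - q₀ * p₀) + N ^ 2 * (a ^ 2 + s) * (K * (q₁ * p₁))
              ≡ q₁ * (K ^ 3 * (p₁ - p₀) + N ^ 2 * s * (K * p₁))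
                + N ^ 2 * a ^ 2 * (K * (q₁ * p₁ - q₀ * p₀))
  third-split = begin
    K ^ 3 * (q₁ * p₁ - q₀ * p₀) + N ^ 2 * (a ^ 2 + s) * (K * (q₁ * p₁))
      ≡⟨ split K N a s q₀ q₁ p₀ p₁ ⟩
    q₁ * (K ^ 3 * (p₁ - p₀) + N ^ 2 * s * (K * p₁)) + N ^ 2 * a ^ 2 * (K * (q₁ * p₁ - q₀ * p₀))
      + K * p₀ * (K * K * (q₁ - q₀) + c * c * q₀)
      ≡⟨ cong (λ z → q₁ * (K ^ 3 * (p₁ - p₀) + N ^ 2 * s * (K * p₁))
                     + N ^ 2 * a ^ 2 * (K * (q₁ * p₁ - q₀ * p₀)) + K * p₀ * (z + c * c * q₀))
              square-step ⟩
    q₁ * (K ^ 3 * (p₁ - p₀) + N ^ 2 * s * (K * p₁)) + N ^ 2 * a ^ 2 * (K * (q₁ * p₁ - q₀ * p₀))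
      + K * p₀ * (- (c * c) * q₀ + c * c * q₀)
      ≡⟨ cancel (q₁ * (K ^ 3 * (p₁ - p₀) + N ^ 2 * s * (K * p₁)))
                (N ^ 2 * a ^ 2 * (K * (q₁ * p₁ - q₀ * p₀))) (K * p₀) (c * c) q₀ ⟩
    q₁ * (K ^ 3 * (p₁ - p₀) + N ^ 2 * s * (K * p₁)) + N ^ 2 * a ^ 2 * (K * (q₁ * p₁ - q₀ * p₀))
      ∎
    where
    split : ∀ K N a s q₀ q₁ p₀ p₁ →
      K * (K * (K * 1ℤ)) * (q₁ * p₁ - q₀ * p₀) + N * (N * 1ℤ) * (a * (a * 1ℤ) + s) * (K * (q₁ * p₁))
        ≡ q₁ * (K * (K * (K * 1ℤ)) * (p₁ - p₀) + N * (N * 1ℤ) * s * (K * p₁))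
          + N * (N * 1ℤ) * (a * (a * 1ℤ)) * (K * (q₁ * p₁ - q₀ * p₀))
          + K * p₀ * (K * K * (q₁ - q₀) + (a * N) * (a * N) * q₀)
    split = solve-∀
    cancel : ∀ x y z u v → x + y + z * (- u * v + u * v) ≡ x + y
    cancel = solve-∀

P : (m : ℕ) → (Fin m → ℤ) → ℕ → ℕ → ℤ
P m a n k = prodFin m (λ i → Q (a i * + n) k)

product-adapted : ∀ m (a : Fin m → ℤ) n j →
  Adapted (+ n) (+ suc j) (sumFin m (λ i → a i ^ 2)) (P m a n j) (P m a n (suc j))
product-adapted zero    a n j = adapted-one (+ n) (+ suc j)
product-adapted (suc m) a n j =
  adapted-* a₀ (Q c j) (Q c (suc j)) (Q-step-square c j) (Q-step-divisible c j)
    (product-adapted m (λ i → a (Fin.suc i)) n j)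
  where
  a₀ = a Fin.zero
  c = a₀ * + n

summation-by-parts : ∀ (f p : ℕ → ℤ) t →
  sumTo (suc t) (λ k → (f (suc k) - f k) * p k)
    ≡ f (suc t) * p t - f 0 * p 0 - sumTo t (λ k → f (suc k) * (p (suc k) - p k))
summation-by-parts f p zero    = base (f 1) (f 0) (p 0)
  where
  base : ∀ f₁ f₀ p₀ → 0ℤ + (f₁ - f₀) * p₀ ≡ f₁ * p₀ - f₀ * p₀ - 0ℤ
  base = solve-∀
summation-by-parts f p (suc t) = begin
  sumTo (suc t) L + L (suc t)
    ≡⟨ cong (_+ L (suc t)) (summation-by-parts f p t) ⟩
  f (suc t) * p t - f 0 * p 0 - sumTo t U + (f (suc (suc t)) - f (suc t)) * p (suc t)
    ≡⟨ step (f (suc t)) (f (suc (suc t))) (p t) (p (suc t)) (f 0 * p 0) (sumTo t U) ⟩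
  f (suc (suc t)) * p (suc t) - f 0 * p 0 - (sumTo t U + U t)
    ∎
  where
  L U : ℕ → ℤ
  L k = (f (suc k) - f k) * p k
  U k = f (suc k) * (p (suc k) - p k)
  step : ∀ f₁ f₂ p₀ p₁ z S →
    f₁ * p₀ - z - S + (f₂ - f₁) * p₁ ≡ f₂ * p₁ - z - (S + f₁ * (p₁ - p₀))
  step = solve-∀

∣-sum-combination : ∀ {D} M (u v : ℕ → ℤ) → (∀ k → D ∣ˢ u k + M * v k) →
  ∀ t → D ∣ˢ sumTo t u + M * sumTo t v
∣-sum-combination {D} M u v termwise zero    = subst (D ∣ˢ_) (sym (empty M)) ∣-zero
  where
  empty : ∀ M → 0ℤ + M * 0ℤ ≡ 0ℤ
  empty = solve-∀
∣-sum-combination {D} M u v termwise (suc t) =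
  subst (D ∣ˢ_) (sym (regroup (sumTo t u) (u t) (sumTo t v) (v t) M))
    (∣m∣n⇒∣m+n (∣-sum-combination M u v termwise t) (termwise t))
  where
  regroup : ∀ U u V v M → U + u + M * (V + v) ≡ (U + M * V) + (u + M * v)
  regroup = solve-∀

quotient-by-square : ∀ g k → (g * (+ suc k) ^ 3) /ℕ (suc k ℕ.* suc k) ≡ g * + suc k
quotient-by-square g k = begin
  (g * K ^ 3) /ℕ (suc k ℕ.* suc k)
    ≡⟨ cong (_/ℕ (suc k ℕ.* suc k))
         (trans (regroup g K) (cong (g * K *_) (sym (pos-* (suc k) (suc k))))) ⟩
  (g * K * + (suc k ℕ.* suc k)) /ℕ (suc k ℕ.* suc k)
    ≡⟨ /ℕ-exact (g * K) (suc k ℕ.* suc k) ⟩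
  g * K ∎
  where
  K = + suc k
  regroup : ∀ g K → g * (K * (K * (K * 1ℤ))) ≡ g * K * (K * K)
  regroup = solve-∀

-- The k-th term of the reduced sum: if K = k+1 has K³ ∣ F and (p₀, p₁) is adapted, then
--   F (p₁ - p₀) + N² s (F/K²) p₁ = (F/K³)·(K³(p₁ - p₀) + N² s K p₁)  is divisible by N³.
term-divisible : ∀ {N s p₀ p₁} k F → (+ suc k) ^ 3 ∣ˢ F → Adapted N (+ suc k) s p₀ p₁ →
  N ^ 3 ∣ˢ F * (p₁ - p₀) + N ^ 2 * s * ((F /ℕ (suc k ℕ.* suc k)) * p₁)
term-divisible {N} {s} {p₀} {p₁} k F (divides g refl) adapted =
  subst (N ^ 3 ∣ˢ_) (sym factored) (∣n⇒∣m*n g (third-order adapted))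
  where
  K = + suc k
  factored : g * K ^ 3 * (p₁ - p₀) + N ^ 2 * s * ((g * K ^ 3) /ℕ (suc k ℕ.* suc k) * p₁)
           ≡ g * (K ^ 3 * (p₁ - p₀) + N ^ 2 * s * (K * p₁))
  factored = begin
    g * K ^ 3 * (p₁ - p₀) + N ^ 2 * s * ((g * K ^ 3) /ℕ (suc k ℕ.* suc k) * p₁)
      ≡⟨ cong (λ z → g * K ^ 3 * (p₁ - p₀) + N ^ 2 * s * (z * p₁)) (quotient-by-square g k) ⟩
    g * K ^ 3 * (p₁ - p₀) + N ^ 2 * s * (g * K * p₁)
      ≡⟨ factor g K N s p₀ p₁ ⟩
    g * (K ^ 3 * (p₁ - p₀) + N ^ 2 * s * (K * p₁))
      ∎
    where
    factor : ∀ g K N s p₀ p₁ →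
      g * (K * (K * (K * 1ℤ))) * (p₁ - p₀) + N * (N * 1ℤ) * s * (g * K * p₁)
        ≡ g * (K * (K * (K * 1ℤ)) * (p₁ - p₀) + N * (N * 1ℤ) * s * (K * p₁))
    factor = solve-∀

-- Theorem 4.2.  After summation by parts the difference of the two sides is
--   f(n) P(n-1) - f(0) P(0) - Σ_{k<n-1} [f(k+1)(P(k+1) - P(k)) + n² S (f(k+1)/(k+1)²) P(k+1)],
-- and n³ divides f(n), f(0) = 0 and every bracket (term-divisible with product-adapted).
theorem4p2 : (m : ℕ) → 1 ≤ m → (a : Fin m → ℤ) → (f : ℕ → ℤ) →
    (∀ k → (+ k) ^ 3 ∣ f k) →
    (n : ℕ) → 1 ≤ n →
    (+ n) ^ 3 ∣
      (sumTo n (λ k → (f (suc k) - f k) * prodFin m (λ i → binom (a i * + n - + 1) k * binom (- (a i * + n) - + 1) k))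
       - (+ n) ^ 2 * sumFin m (λ i → a i ^ 2)
         * sumTo (n ∸ 1) (λ j → (f (suc j) /ℕ (suc j ℕ.* suc j)) * prodFin m (λ i → binom (a i * + n - + 1) (suc j) * binom (- (a i * + n) - + 1) (suc j))))
theorem4p2 m _ a f f-cubes zero    ()
theorem4p2 m _ a f f-cubes (suc t) _  =
  ∣⇒∣ᵤ (subst ((+ n) ^ 3 ∣ˢ_) (sym rearranged)
    (∣m∣n⇒∣m-n (∣m∣n⇒∣m-n boundary-n boundary-0)
      (∣-sum-combination M U V
        (λ k → term-divisible k (f (suc k)) (cube-∣ (suc k)) (product-adapted m a n k))
        t)))
  where
  n = suc t
  p = P m a n
  M = (+ n) ^ 2 * sumFin m (λ i → a i ^ 2)
  U V : ℕ → ℤ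
  U k = f (suc k) * (p (suc k) - p k)
  V k = (f (suc k) /ℕ (suc k ℕ.* suc k)) * p (suc k)

  cube-∣ : ∀ k → (+ k) ^ 3 ∣ˢ f k
  cube-∣ k = ∣ᵤ⇒∣ {i = f k} (f-cubes k)

  boundary-n : (+ n) ^ 3 ∣ˢ f n * p t
  boundary-n = ∣m⇒∣m*n (p t) (cube-∣ n)
  -- The hypothesis at k = 0 reads 0 ∣ f(0), and n³ ∣ 0.
  boundary-0 : (+ n) ^ 3 ∣ˢ f 0 * p 0
  boundary-0 = ∣m⇒∣m*n (p 0) (∣-trans ∣-zero (cube-∣ 0))

  rearranged : sumTo n (λ k → (f (suc k) - f k) * p k) - M * sumTo t V
             ≡ f n * p t - f 0 * p 0 - (sumTo t U + M * sumTo t V)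
  rearranged = trans (cong (_- M * sumTo t V) (summation-by-parts f p t))
                     (regroup (f n * p t) (f 0 * p 0) (sumTo t U) (M * sumTo t V))
    where
    regroup : ∀ x y u w → x - y - u - w ≡ x - y - (u + w)
    regroup = solve-∀
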